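{- Let $H=(V,E,\ell)$ be an edge-colored hypergraph with colors $[k]$ and rank $r$. For each node $v$ and color $c$ let $n_v(c)=|\{e\in E: v\in e,\ \ell(e)=c\}|$, and for each $v$ fix an ordering $\pi_v(1),\dots,\pi_v(k)$ of $[k]$ with $n_v(\pi_v(1))\ge n_v(\pi_v(2))\ge\cdots\ge n_v(\pi_v(k))$ (ties broken arbitrarily); let $d_v$ be the number of hyperedges containing $v$. Consider the following greedy algorithms. (i) Greedy for Local Overlapping ECC with budget $b\ge 1$: set $\lambda(v)=\{\pi_v(i): 1\le i\le b\}$ for every $v$. (ii) Greedy for Global Overlapping ECC with budget $b\ge 0$: start with $\lambda(v)=\{\pi_v(1)\}$ for every $v$; then repeat $b$ times: choose a node $u$ maximizing $n_u(\pi_u(|\lambda(u)|+1))$ and add $\pi_u(|\lambda(u)|+1)$ to $\lambda(u)$. (iii) Greedy for Robust ECC with budget $b\ge 0$: start with $\lambda(v)=\{\pi_v(1)\}$ for every $v$; then repeat $b$ times: among nodes not yet deleted, choose $u$ maximizing $d_u-n_u(\pi_u(1))$ and set $\lambda(u)=[k]$ (delete $u$). Then each of these algorithms outputs a feasible solution for its respective problem whose number of mistakes is at most $r$ times the optimal number of mistakes for that problem; i.e., the greedy approach is an $r$-approximation for Local Overlapping ECC, Global Overlapping ECC, and Robust ECC.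
   Context: An edge-colored hypergraph $H=(V,E,\ell)$ consists of a finite node set $V$, a finite collection $E$ of hyperedges (subsets of $V$), and a labeling $\ell:E\to[k]=\{1,\dots,k\}$ of hyperedges by colors; the rank $r$ is the maximum hyperedge size. A coloring is a map $\lambda:V\to 2^{[k]}$. The coloring makes a mistake at $e\in E$ (e is unsatisfied) if some $v\in e$ has $\ell(e)\notin\lambda(v)$; the objective is to minimize the number of hyperedges at which $\lambda$ makes a mistake. Local Overlapping ECC (budget $b\ge1$) restricts to colorings with $|\lambda(v)|\le b$ for all $v$. Global Overlapping ECC (budget $b\ge 0$) restricts to colorings with $|\lambda(v)|\ge 1$ for all $v$ and $\sum_{v\in V}(|\lambda(v)|-1)\le b$. Robust ECC (budget $b\ge0$) restricts to colorings in which at most $b$ nodes $v$ have $\lambda(v)=[k]$ (these nodes are called deleted) and every other node $u$ has $|\lambda(u)|=1$. -}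

module Defs where

open import Data.Nat using (ℕ; zero; suc; _≤_; _<_; _∸_; _⊔_; _<?_; NonZero)
open import Data.Fin using (Fin; toℕ; fromℕ<; _≟_) renaming (_≤_ to _≤ᶠ_)
open import Data.Fin.Properties using (any?)
open import Data.Fin.Subset using (Subset; _∈_; _∉_; ⁅_⁆; ⊤; ∣_∣; inside)
open import Data.Fin.Subset.Properties using (_∈?_)
open import Data.Fin.Permutation using (Permutation′; _⟨$⟩ʳ_; _⟨$⟩ˡ_)
open import Data.Vec using (tabulate; lookup; _[_]≔_)
open import Data.List using (List; length; filter; map; allFin; foldr)
open import Data.Nat.ListAction using (sum)
open import Data.Product using (_×_; _,_; ∃; proj₁; proj₂)
open import Data.Bool using (if_then_else_)
open import Relation.Nullary using (¬?; Dec)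
open import Relation.Nullary.Decidable using (⌊_⌋; _×-dec_)
open import Relation.Binary.PropositionalEquality using (_≡_)

-- A hyperedge is a subset of V together with its color label; E is a
-- finite collection (a list, so repeated hyperedges are allowed).

Edge : ℕ → ℕ → Set
Edge n k = Subset n × Fin k

Hypergraph : ℕ → ℕ → Set
Hypergraph n k = List (Edge n k)

rank : ∀ {n k} → Hypergraph n k → ℕ
rank E = foldr (λ e acc → ∣ proj₁ e ∣ ⊔ acc) 0 E

Coloring : ℕ → ℕ → Set
Coloring n k = Fin n → Subset k

Mistake : ∀ {n k} → Coloring n k → Edge n k → Set
Mistake μ (S , c) = ∃ λ v → v ∈ S × c ∉ μ v

mistake? : ∀ {n k} (μ : Coloring n k) (e : Edge n k) → Dec (Mistake μ e)
mistake? μ (S , c) = any? (λ v → (v ∈? S) ×-dec ¬? (c ∈? μ v))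

mistakes : ∀ {n k} → Hypergraph n k → Coloring n k → ℕ
mistakes E μ = length (filter (mistake? μ) E)

nv : ∀ {n k} → Hypergraph n k → Fin n → Fin k → ℕ
nv E v c = length (filter (λ e → (v ∈? proj₁ e) ×-dec (proj₂ e ≟ c)) E)

dv : ∀ {n k} → Hypergraph n k → Fin n → ℕ
dv E v = length (filter (λ e → v ∈? proj₁ e) E)

-- Orderings π_v of [k] (0-based: π_v(zero) is the paper's π_v(1)),
-- sorted by non-increasing n_v.

Ordering : ℕ → ℕ → Set
Ordering n k = Fin n → Permutation′ k

Sorted : ∀ {n k} → Hypergraph n k → Ordering n k → Set
Sorted {n} {k} E π =
  ∀ (v : Fin n) (i j : Fin k) → i ≤ᶠ j → nv E v (π v ⟨$⟩ʳ j) ≤ nv E v (π v ⟨$⟩ʳ i)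

firstColors : ∀ {k} → Permutation′ k → ℕ → Subset k
firstColors p m = tabulate (λ c → ⌊ toℕ (p ⟨$⟩ˡ c) <? m ⌋)

fin0 : ∀ k → .{{NonZero k}} → Fin k
fin0 (suc k) = Fin.zero

LocalFeasible : ∀ {n k} → ℕ → Coloring n k → Set
LocalFeasible b μ = ∀ v → ∣ μ v ∣ ≤ b

GlobalFeasible : ∀ {n k} → ℕ → Coloring n k → Set
GlobalFeasible {n} b μ =
  (∀ v → 1 ≤ ∣ μ v ∣) × sum (map (λ v → ∣ μ v ∣ ∸ 1) (allFin n)) ≤ b

RobustFeasible : ∀ {n k} → ℕ → Coloring n k → Set
RobustFeasible {n} b μ =
  ∃ λ (D : Subset n) → ∣ D ∣ ≤ b ×
    (∀ v → (v ∈ D → μ v ≡ ⊤) × (v ∉ D → ∣ μ v ∣ ≡ 1))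

localGreedy : ∀ {n k} → Ordering n k → ℕ → Coloring n k
localGreedy π b v = firstColors (π v) b

-- (ii) Global greedy.  State: m v = |λ(v)|, λ(v) = first m v colors of π_v.

globalOut : ∀ {n k} → Ordering n k → (Fin n → ℕ) → Coloring n k
globalOut π m v = firstColors (π v) (m v)

bump : ∀ {n} → (Fin n → ℕ) → Fin n → (Fin n → ℕ)
bump m u w = if ⌊ w ≟ u ⌋ then suc (m w) else m w

data GlobalStep {n k} (E : Hypergraph n k) (π : Ordering n k)
       (m : Fin n → ℕ) : (Fin n → ℕ) → Set where
  add  : (u : Fin n) (lt : m u < k) →
         (∀ w (ltw : m w < k) →
            nv E w (π w ⟨$⟩ʳ fromℕ< ltw) ≤ nv E u (π u ⟨$⟩ʳ fromℕ< lt)) →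
         GlobalStep E π m (bump m u)
  full : (∀ w → k ≤ m w) → GlobalStep E π m m

data GlobalRun {n k} (E : Hypergraph n k) (π : Ordering n k) :
       ℕ → (Fin n → ℕ) → Set where
  start : GlobalRun E π 0 (λ _ → 1)
  step  : ∀ {t m m'} → GlobalRun E π t m → GlobalStep E π m m' →
          GlobalRun E π (suc t) m'

robustOut : ∀ {n k} → .{{NonZero k}} → Ordering n k → Subset n → Coloring n k
robustOut {k = k} π D v = if lookup D v then ⊤ else ⁅ π v ⟨$⟩ʳ fin0 k ⁆

robustScore : ∀ {n k} → .{{NonZero k}} → Hypergraph n k → Ordering n k → Fin n → ℕ
robustScore {k = k} E π u = dv E u ∸ nv E u (π u ⟨$⟩ʳ fin0 k)

data RobustStep {n k} .{{_ : NonZero k}} (E : Hypergraph n k) (π : Ordering n k)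
       (D : Subset n) : Subset n → Set where
  delete : (u : Fin n) → u ∉ D →
           (∀ w → w ∉ D → robustScore E π w ≤ robustScore E π u) →
           RobustStep E π D (D [ u ]≔ inside)
  none   : (∀ w → w ∈ D) → RobustStep E π D D

data RobustRun {n k} .{{_ : NonZero k}} (E : Hypergraph n k) (π : Ordering n k) :
       ℕ → Subset n → Set where
  start : RobustRun E π 0 (tabulate (λ _ → Data.Bool.false))
  step  : ∀ {t D D'} → RobustRun E π t D → RobustStep E π D D' →
          RobustRun E π (suc t) D'

{-# OPTIONS --safe #-}
module Submission where

-- Call an incidence (v , e) with v ∈ e satisfied by a coloring λ when ℓ(e) ∈ λ(v). A hyperedge with
-- a mistake has between 1 and r unsatisfied incidences, and satisfied plus unsatisfied incidences
-- always add up to Σ_v d_v; so a coloring satisfying at least as many incidences as μ makes at most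
-- r times as many mistakes as μ. The incidences satisfied at v by a colour set A number
-- Σ_{c ∈ A} n_v(c), which is at most the sum of the |A| largest counts n_v(π_v(1)) + ⋯ . Maximising
-- satisfied incidences thus becomes a separable problem in which every node offers a non-increasing
-- sequence of marginal gains, and an exchange argument shows that spending the budget one unit at a
-- time on the largest available marginal gain is optimal. This is what the greedy algorithms do:
-- locally with budget b per node, globally with the gains n_v(π_v(j+1)) of extra colours, and for
-- Robust ECC with the single gain d_v − n_v(π_v(1)) of deleting v.

open import Defs
open import Data.Bool using (Bool; true; false; not; _∧_; if_then_else_)
open import Data.Bool.Properties using (∧-identityʳ)
open import Data.Fin using (Fin; toℕ; fromℕ<; _≟_) renaming (zero to fzero; suc to fsuc)
open import Data.Fin.Permutation using (Permutation′; _⟨$⟩ʳ_; inverseˡ)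
open import Data.Fin.Properties using (toℕ-fromℕ<; any?)
open import Data.Fin.Subset using (Subset; _∉_; ∣_∣; ⊤; ⁅_⁆; inside)
open import Data.Fin.Subset.Properties using (_∈?_; ∣⁅x⁆∣≡1)
open import Data.List as List using (List; []; _∷_; length; filter; map; allFin)
open import Data.List.Properties using (map-tabulate)
import Data.Nat.ListAction as ListAction
open import Data.Nat
  using (ℕ; zero; suc; pred; _+_; _*_; _∸_; _≤_; _<_; _≥_; _<?_; _⊓_; z≤n; s≤s; NonZero; >-nonZero)
open import Data.Nat.Properties
  using (≤-refl; ≤-trans; ≤-reflexive; ≤-pred; n≤1+n; m≤m+n; m≤n+m; ≮⇒≥; m≤m⊔n; m≤n⊔m;
         m⊓n≤m; m≤n⇒m⊓n≡m; ⊓-zeroʳ; +-identityʳ; +-assoc; +-comm; +-mono-≤; +-monoʳ-≤;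
         +-cancelʳ-≤; +-∸-assoc; m+[n∸m]≡n; suc-pred; *-comm; *-zeroʳ; *-identityʳ; +-*-semiring;
         module ≤-Reasoning)
open import Algebra.Properties.Semiring.Sum +-*-semiring
  using (sum-syntax; sum-cong-≗; sum-replicate-zero; sum-permute; ∑-comm; ∑-distrib-+;
         *-distribˡ-sum; *-distribʳ-sum)
open import Data.Product using (_×_; _,_; proj₁; proj₂)
open import Data.Vec using (lookup; _[_]≔_) renaming ([] to []ᵛ; _∷_ to _∷ᵛ_)
open import Data.Vec.Functional using (updateAt)
open import Data.Vec.Functional.Properties
  using (updateAt-updates; updateAt-minimal; updateAt-updateAt-local; updateAt-id)
open import Data.Vec.Properties
  using (lookup⇒[]=; []=⇒lookup; lookup-replicate; lookup∘tabulate; lookup∘update; lookup∘update′)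
open import Function using (_∘_; id)
open import Relation.Binary using (_Preserves_⟶_)
open import Relation.Binary.PropositionalEquality
open import Relation.Nullary using (does; yes; no; ¬_; contradiction)
open import Relation.Nullary.Decidable using (⌊_⌋; isYes≗does)
open import Relation.Unary using (Decidable)

⟦_⟧ : Bool → ℕ
⟦ true ⟧  = 1
⟦ false ⟧ = 0

⟦⟧-split : ∀ a b → ⟦ a ⟧ ≡ ⟦ a ∧ not b ⟧ + ⟦ a ∧ b ⟧
⟦⟧-split false b     = refl
⟦⟧-split true  true  = refl
⟦⟧-split true  false = refl

⟦∧⟧≤⟦⟧ : ∀ a b → ⟦ a ∧ b ⟧ ≤ ⟦ a ⟧
⟦∧⟧≤⟦⟧ false b = z≤n
⟦∧⟧≤⟦⟧ true  b = ⟦⟧≤1 b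
  where
  ⟦⟧≤1 : ∀ b → ⟦ b ⟧ ≤ 1
  ⟦⟧≤1 true  = ≤-refl
  ⟦⟧≤1 false = z≤n

∑-mono-≤ : ∀ {n} {f g : Fin n → ℕ} → (∀ i → f i ≤ g i) → ∑[ i < n ] f i ≤ ∑[ i < n ] g i
∑-mono-≤ {zero}  f≤g = z≤n
∑-mono-≤ {suc n} f≤g = +-mono-≤ (f≤g fzero) (∑-mono-≤ (f≤g ∘ fsuc))

term≤∑ : ∀ {n} (f : Fin n → ℕ) i → f i ≤ ∑[ j < n ] f j
term≤∑ f fzero    = m≤m+n (f fzero) _
term≤∑ f (fsuc i) = ≤-trans (term≤∑ (f ∘ fsuc) i) (m≤n+m _ (f fzero))

∑-δ : ∀ {k} (d : Fin k) (f : Fin k → ℕ) → ∑[ c < k ] (⟦ does (d ≟ c) ⟧ * f c) ≡ f d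
∑-δ {suc k} fzero    f = trans (cong₂ _+_ (+-identityʳ (f fzero)) (sum-replicate-zero k)) (+-identityʳ _)
∑-δ {suc k} (fsuc d) f = ∑-δ d (f ∘ fsuc)

∑-updateAt : ∀ {n} (h : Fin n → ℕ → ℕ) (x : Fin n → ℕ) u (g : ℕ → ℕ) {d} →
             h u (g (x u)) ≡ h u (x u) + d →
             ∑[ v < n ] h v (updateAt x u g v) ≡ ∑[ v < n ] h v (x v) + d
∑-updateAt {suc n} h x fzero g {d} eq = begin
  h fzero (g (x fzero)) + S        ≡⟨ cong (_+ S) eq ⟩
  h fzero (x fzero) + d + S        ≡⟨ +-assoc (h fzero (x fzero)) d S ⟩
  h fzero (x fzero) + (d + S)      ≡⟨ cong (h fzero (x fzero) +_) (+-comm d S) ⟩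
  h fzero (x fzero) + (S + d)      ≡⟨ +-assoc (h fzero (x fzero)) S d ⟨
  h fzero (x fzero) + S + d        ∎
  where
  open ≡-Reasoning
  S = ∑[ v < n ] h (fsuc v) (x (fsuc v))
∑-updateAt {suc n} h x (fsuc u) g eq =
  trans (cong (h fzero (x fzero) +_) (∑-updateAt (h ∘ fsuc) (x ∘ fsuc) u g eq))
        (sym (+-assoc (h fzero (x fzero)) _ _))

length-filter≡∑ : ∀ {A : Set} {P : A → Set} (P? : Decidable P) (xs : List A) →
                  length (filter P? xs) ≡ ∑[ i < length xs ] ⟦ does (P? (List.lookup xs i)) ⟧
length-filter≡∑ P? []       = refl
length-filter≡∑ P? (x ∷ xs) with does (P? x)
... | true  = cong suc (length-filter≡∑ P? xs)
... | false = length-filter≡∑ P? xs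

sum-map-allFin : ∀ {n} (f : Fin n → ℕ) → ListAction.sum (map f (allFin n)) ≡ ∑[ i < n ] f i
sum-map-allFin f = trans (cong ListAction.sum (map-tabulate id f)) (sum-tabulate f)
  where
  sum-tabulate : ∀ {n} (f : Fin n → ℕ) → ListAction.sum (List.tabulate f) ≡ ∑[ i < n ] f i
  sum-tabulate {zero}  f = refl
  sum-tabulate {suc n} f = cong (f fzero +_) (sum-tabulate (f ∘ fsuc))

does-∈? : ∀ {n} (x : Fin n) (p : Subset n) → does (x ∈? p) ≡ lookup p x
does-∈? fzero    (true ∷ᵛ p)  = refl
does-∈? fzero    (false ∷ᵛ p) = refl
does-∈? (fsuc x) (_ ∷ᵛ p)     = does-∈? x p

∉⇒lookup≡false : ∀ {n} {x : Fin n} {p : Subset n} → x ∉ p → lookup p x ≡ false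
∉⇒lookup≡false {x = x} {p} x∉p with lookup p x in eq
... | true  = contradiction (lookup⇒[]= x p eq) x∉p
... | false = refl

lookup≡false⇒∉ : ∀ {n} {x : Fin n} {p : Subset n} → lookup p x ≡ false → x ∉ p
lookup≡false⇒∉ p[x]≡false x∈p with trans (sym ([]=⇒lookup x∈p)) p[x]≡false
... | ()

∣p∣≡∑ : ∀ {n} (p : Subset n) → ∣ p ∣ ≡ ∑[ x < n ] ⟦ lookup p x ⟧
∣p∣≡∑ []ᵛ         = refl
∣p∣≡∑ (true ∷ᵛ p)  = cong suc (∣p∣≡∑ p)
∣p∣≡∑ (false ∷ᵛ p) = ∣p∣≡∑ p

lookup-⁅⁆ : ∀ {k} (x c : Fin k) → lookup ⁅ x ⁆ c ≡ does (x ≟ c)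
lookup-⁅⁆ fzero    fzero    = refl
lookup-⁅⁆ fzero    (fsuc c) = lookup-replicate c false
lookup-⁅⁆ (fsuc x) fzero    = refl
lookup-⁅⁆ (fsuc x) (fsuc c) = lookup-⁅⁆ x c

∣p∣≡∑-permute : ∀ {k} (σ : Permutation′ k) (A : Subset k) → ∣ A ∣ ≡ ∑[ i < k ] ⟦ lookup A (σ ⟨$⟩ʳ i) ⟧
∣p∣≡∑-permute σ A = trans (∣p∣≡∑ A) (sum-permute (λ c → ⟦ lookup A c ⟧) σ)

prefix : (ℕ → ℕ) → ℕ → ℕ
prefix f j = ∑[ i < j ] f (toℕ i)

prefix-suc : ∀ (f : ℕ → ℕ) j → prefix f (suc j) ≡ prefix f j + f j
prefix-suc f zero    = +-identityʳ (f 0)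
prefix-suc f (suc j) = trans (cong (f 0 +_) (prefix-suc (f ∘ suc) j)) (sym (+-assoc (f 0) _ _))

prefix-monoʳ-≤ : ∀ (f : ℕ → ℕ) {i j} → i ≤ j → prefix f i ≤ prefix f j
prefix-monoʳ-≤ f z≤n       = z≤n
prefix-monoʳ-≤ f (s≤s i≤j) = +-monoʳ-≤ (f 0) (prefix-monoʳ-≤ (f ∘ suc) i≤j)

prefix-monoˡ-≤ : ∀ {f g : ℕ → ℕ} → (∀ j → f j ≤ g j) → ∀ m → prefix f m ≤ prefix g m
prefix-monoˡ-≤ f≤g m = ∑-mono-≤ {m} (f≤g ∘ toℕ)

prefix-of-zeros : ∀ (f : ℕ → ℕ) → (∀ j → f j ≡ 0) → ∀ m → prefix f m ≡ 0
prefix-of-zeros f f≡0 m = trans (sum-cong-≗ {m} (f≡0 ∘ toℕ)) (sum-replicate-zero m)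

Antitone : (ℕ → ℕ) → Set
Antitone f = f Preserves _≤_ ⟶ _≥_

∑-selected≤prefix : ∀ {k} (f : ℕ → ℕ) → Antitone f → (I : Fin k → Bool) →
                    ∑[ i < k ] (⟦ I i ⟧ * f (toℕ i)) ≤ prefix f (∑[ i < k ] ⟦ I i ⟧)
∑-selected≤prefix {zero}  f anti I = z≤n
∑-selected≤prefix {suc k} f anti I with I fzero
... | true  = +-mono-≤ (≤-reflexive (+-identityʳ (f 0))) (∑-selected≤prefix (f ∘ suc) (anti ∘ s≤s) (I ∘ fsuc))
... | false = ≤-trans (∑-selected≤prefix (f ∘ suc) (anti ∘ s≤s) (I ∘ fsuc))
                      (prefix-monoˡ-≤ (λ j → anti (n≤1+n j)) (∑[ i < k ] ⟦ I (fsuc i) ⟧))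

∑-firsts≡prefix : ∀ {k} (f : ℕ → ℕ) → (∀ j → k ≤ j → f j ≡ 0) → ∀ m →
                  ∑[ i < k ] (⟦ does (toℕ i <? m) ⟧ * f (toℕ i)) ≡ prefix f m
∑-firsts≡prefix {zero}  f vanish m       = sym (prefix-of-zeros f (λ j → vanish j z≤n) m)
∑-firsts≡prefix {suc k} f vanish zero    = sum-replicate-zero (suc k)
∑-firsts≡prefix {suc k} f vanish (suc m) =
  cong₂ _+_ (+-identityʳ (f 0)) (∑-firsts≡prefix (f ∘ suc) (λ j k≤j → vanish (suc j) (s≤s k≤j)) m)

extendByZero : ∀ {k} → (Fin k → ℕ) → ℕ → ℕ
extendByZero {zero}  g j       = 0
extendByZero {suc k} g zero    = g fzero
extendByZero {suc k} g (suc j) = extendByZero (g ∘ fsuc) j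

extendByZero-toℕ : ∀ {k} (g : Fin k → ℕ) i → extendByZero g (toℕ i) ≡ g i
extendByZero-toℕ g fzero    = refl
extendByZero-toℕ g (fsuc i) = extendByZero-toℕ (g ∘ fsuc) i

extendByZero-fromℕ< : ∀ {k} (g : Fin k → ℕ) {j} (j<k : j < k) → extendByZero g j ≡ g (fromℕ< j<k)
extendByZero-fromℕ< g j<k =
  trans (cong (extendByZero g) (sym (toℕ-fromℕ< j<k))) (extendByZero-toℕ g (fromℕ< j<k))

extendByZero-vanishes : ∀ {k} (g : Fin k → ℕ) {j} → k ≤ j → extendByZero g j ≡ 0
extendByZero-vanishes {zero}  g k≤j       = refl
extendByZero-vanishes {suc k} g (s≤s k≤j) = extendByZero-vanishes (g ∘ fsuc) k≤j

extendByZero-≤ : ∀ {k} (g : Fin k → ℕ) {b} → (∀ i → g i ≤ b) → ∀ j → extendByZero g j ≤ b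
extendByZero-≤ {zero}  g g≤b j       = z≤n
extendByZero-≤ {suc k} g g≤b zero    = g≤b fzero
extendByZero-≤ {suc k} g g≤b (suc j) = extendByZero-≤ (g ∘ fsuc) (g≤b ∘ fsuc) j

extendByZero-antitone : ∀ {k} (g : Fin k → ℕ) → (∀ i j → toℕ i ≤ toℕ j → g j ≤ g i) →
                        Antitone (extendByZero g)
extendByZero-antitone {zero}  g anti _                   = z≤n
extendByZero-antitone {suc k} g anti {zero}  {zero}  _   = ≤-refl
extendByZero-antitone {suc k} g anti {zero}  {suc j} _   =
  extendByZero-≤ (g ∘ fsuc) (λ i → anti fzero (fsuc i) z≤n) j
extendByZero-antitone {suc k} g anti {suc i} {suc j} (s≤s i≤j) =
  extendByZero-antitone (g ∘ fsuc) (λ i j i≤j → anti (fsuc i) (fsuc j) (s≤s i≤j)) i≤j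

∑⟦<⟧≡⊓ : ∀ k m → ∑[ i < k ] ⟦ does (toℕ i <? m) ⟧ ≡ m ⊓ k
∑⟦<⟧≡⊓ zero    m       = sym (⊓-zeroʳ m)
∑⟦<⟧≡⊓ (suc k) zero    = sum-replicate-zero (suc k)
∑⟦<⟧≡⊓ (suc k) (suc m) = cong suc (∑⟦<⟧≡⊓ k m)

lookup-firstColors : ∀ {k} (σ : Permutation′ k) m i → lookup (firstColors σ m) (σ ⟨$⟩ʳ i) ≡ does (toℕ i <? m)
lookup-firstColors σ m i =
  trans (lookup∘tabulate _ (σ ⟨$⟩ʳ i)) (trans (cong (λ j → ⌊ toℕ j <? m ⌋) (inverseˡ σ)) (isYes≗does _))

∣firstColors∣ : ∀ {k} (σ : Permutation′ k) m → ∣ firstColors σ m ∣ ≡ m ⊓ k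
∣firstColors∣ {k} σ m =
  trans (∣p∣≡∑-permute σ (firstColors σ m))
        (trans (sum-cong-≗ (λ i → cong ⟦_⟧ (lookup-firstColors σ m i))) (∑⟦<⟧≡⊓ k m))

module SeparableGreedy {n : ℕ} (δ : Fin n → ℕ → ℕ) (δ-antitone : ∀ v → Antitone (δ v)) where

  size : (Fin n → ℕ) → ℕ
  size x = ∑[ v < n ] x v

  gain : (Fin n → ℕ) → ℕ
  gain x = ∑[ v < n ] prefix (δ v) (x v)

  Optimal : ℕ → (Fin n → ℕ) → Set
  Optimal t x = size x ≤ t × (∀ y → size y ≤ t → gain y ≤ gain x)

  size-step : ∀ x u → size (updateAt x u suc) ≡ size x + 1
  size-step x u = ∑-updateAt (λ _ j → j) x u suc (+-comm 1 (x u))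

  gain-step : ∀ x u → gain (updateAt x u suc) ≡ gain x + δ u (x u)
  gain-step x u = ∑-updateAt (λ v → prefix (δ v)) x u suc (prefix-suc (δ u) (x u))

  gain-mono-≤ : ∀ {x y} → (∀ v → x v ≤ y v) → gain x ≤ gain y
  gain-mono-≤ x≤y = ∑-mono-≤ (λ v → prefix-monoʳ-≤ (δ v) (x≤y v))

  optimal-resp-≗ : ∀ {t x x′} → x ≗ x′ → Optimal t x → Optimal t x′
  optimal-resp-≗ {x = x} {x′} x≗x′ (within , best) =
    subst (_≤ _) (sum-cong-≗ x≗x′) within ,
    λ y y≤t → subst (gain y ≤_) (sum-cong-≗ (λ v → cong (prefix (δ v)) (x≗x′ v))) (best y y≤t)

  optimal-zero : Optimal 0 (λ _ → 0)
  optimal-zero = ≤-reflexive (sum-replicate-zero n) ,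
                 λ y y≤0 → gain-mono-≤ (λ v → ≤-trans (term≤∑ y v) y≤0)

  -- Lowering a competitor y at a node w where it exceeds x brings it back within budget t,
  -- at the price of one marginal gain, which is no larger than δ w (x w).
  exchange : ∀ {t x M} → Optimal t x → (∀ w → δ w (x w) ≤ M) →
             ∀ y → size y ≤ suc t → gain y ≤ gain x + M
  exchange {t} {x} {M} (_ , best) δ≤M y y≤ with any? (λ w → x w <? y w)
  ... | no ¬x<y = ≤-trans (gain-mono-≤ (λ w → ≮⇒≥ (λ y<x → ¬x<y (w , y<x)))) (m≤m+n (gain x) M)
  ... | yes (w , x<y) = begin
    gain y                     ≡⟨ sum-cong-≗ (λ v → cong (prefix (δ v)) (y′⁺≗y v)) ⟨
    gain (updateAt y′ w suc)   ≡⟨ gain-step y′ w ⟩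
    gain y′ + δ w (y′ w)       ≤⟨ +-mono-≤ (best y′ y′≤t) (≤-trans (δ-antitone w x≤y′) (δ≤M w)) ⟩
    gain x + M                 ∎
    where
    open ≤-Reasoning
    y′ : Fin n → ℕ
    y′ = updateAt y w pred
    suc-pred-y : suc (pred (y w)) ≡ y w
    suc-pred-y = suc-pred (y w) {{>-nonZero (≤-trans (s≤s z≤n) x<y)}}
    y′⁺≗y : updateAt y′ w suc ≗ y
    y′⁺≗y v = trans (updateAt-updateAt-local w y suc-pred-y v) (updateAt-id w y v)
    x≤y′ : x w ≤ y′ w
    x≤y′ = subst (x w ≤_) (sym (updateAt-updates w y)) (≤-pred (subst (x w <_) (sym suc-pred-y) x<y))
    y′≤t : size y′ ≤ t
    y′≤t = ≤-pred (begin
      suc (size y′)              ≡⟨ +-comm 1 (size y′) ⟩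
      size y′ + 1                ≡⟨ size-step y′ w ⟨
      size (updateAt y′ w suc)   ≡⟨ sum-cong-≗ y′⁺≗y ⟩
      size y                     ≤⟨ y≤ ⟩
      suc t                      ∎)

  optimal-step : ∀ {t x} → Optimal t x → ∀ u → (∀ w → δ w (x w) ≤ δ u (x u)) →
                 Optimal (suc t) (updateAt x u suc)
  optimal-step {t} {x} opt@(within , _) u δ≤δu =
    subst (_≤ suc t) (sym (trans (size-step x u) (+-comm (size x) 1))) (s≤s within) ,
    λ y y≤ → subst (gain y ≤_) (sym (gain-step x u)) (exchange opt δ≤δu y y≤)

  optimal-idle : ∀ {t x} → Optimal t x → (∀ w → δ w (x w) ≡ 0) → Optimal (suc t) x
  optimal-idle {t} {x} opt@(within , _) δ≡0 =
    ≤-trans within (n≤1+n t) ,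
    λ y y≤ → subst (gain y ≤_) (+-identityʳ (gain x)) (exchange opt (≤-reflexive ∘ δ≡0) y y≤)

∣edge∣≤rank : ∀ {n k} (E : Hypergraph n k) i → ∣ proj₁ (List.lookup E i) ∣ ≤ rank E
∣edge∣≤rank (e ∷ E) fzero    = m≤m⊔n ∣ proj₁ e ∣ (rank E)
∣edge∣≤rank (e ∷ E) (fsuc i) = ≤-trans (∣edge∣≤rank E i) (m≤n⊔m ∣ proj₁ e ∣ (rank E))

module Counting {n k : ℕ} (E : Hypergraph n k) where

  edge : Fin (length E) → Edge n k
  edge = List.lookup E

  incident : Fin (length E) → Fin n → Bool
  incident i = lookup (proj₁ (edge i))

  colour : Fin (length E) → Fin k
  colour i = proj₂ (edge i)

  misses : Coloring n k → Edge n k → ℕ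
  misses μ (S , c) = ∑[ v < n ] ⟦ lookup S v ∧ not (lookup (μ v) c) ⟧

  totalMisses : Coloring n k → ℕ
  totalMisses μ = ∑[ i < length E ] misses μ (edge i)

  satisfied unsatisfied : Fin n → Subset k → ℕ
  satisfied   v A = ∑[ i < length E ] ⟦ incident i v ∧ lookup A (colour i) ⟧
  unsatisfied v A = ∑[ i < length E ] ⟦ incident i v ∧ not (lookup A (colour i)) ⟧

  dv≡∑ : ∀ v → dv E v ≡ ∑[ i < length E ] ⟦ incident i v ⟧
  dv≡∑ v = trans (length-filter≡∑ (λ e → v ∈? proj₁ e) E)
                 (sum-cong-≗ (λ i → cong ⟦_⟧ (does-∈? v (proj₁ (edge i)))))

  nv≡∑ : ∀ v c → nv E v c ≡ ∑[ i < length E ] ⟦ incident i v ∧ does (colour i ≟ c) ⟧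
  nv≡∑ v c = trans (length-filter≡∑ _ E)
    (sum-cong-≗ (λ i → cong (λ b → ⟦ b ∧ does (colour i ≟ c) ⟧) (does-∈? v (proj₁ (edge i)))))

  dv≡unsatisfied+satisfied : ∀ v A → dv E v ≡ unsatisfied v A + satisfied v A
  dv≡unsatisfied+satisfied v A = begin
    dv E v                                 ≡⟨ dv≡∑ v ⟩
    ∑[ i < length E ] ⟦ incident i v ⟧     ≡⟨ sum-cong-≗ (λ i → ⟦⟧-split (incident i v) (lookup A (colour i))) ⟩
    ∑[ i < length E ] (miss i + hit i)     ≡⟨ ∑-distrib-+ miss hit ⟩
    unsatisfied v A + satisfied v A        ∎
    where
    open ≡-Reasoning
    miss hit : Fin (length E) → ℕ
    miss i = ⟦ incident i v ∧ not (lookup A (colour i)) ⟧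
    hit  i = ⟦ incident i v ∧ lookup A (colour i) ⟧

  satisfied≤dv : ∀ v A → satisfied v A ≤ dv E v
  satisfied≤dv v A = ≤-trans (m≤n+m _ _) (≤-reflexive (sym (dv≡unsatisfied+satisfied v A)))

  satisfied-⊤ : ∀ v → satisfied v ⊤ ≡ dv E v
  satisfied-⊤ v = trans (sum-cong-≗ (λ i → cong ⟦_⟧ (trans (cong (incident i v ∧_) (lookup-replicate (colour i) true))
                                                          (∧-identityʳ (incident i v)))))
                        (sym (dv≡∑ v))

  satisfied≡∑nv : ∀ v A → satisfied v A ≡ ∑[ c < k ] (⟦ lookup A c ⟧ * nv E v c)
  satisfied≡∑nv v A = sym (begin
    ∑[ c < k ] (⟦ lookup A c ⟧ * nv E v c)
      ≡⟨ sum-cong-≗ (λ c → trans (*-comm ⟦ lookup A c ⟧ _) (cong (_* ⟦ lookup A c ⟧) (nv≡∑ v c))) ⟩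
    ∑[ c < k ] ((∑[ i < length E ] ⟦ incident i v ∧ does (colour i ≟ c) ⟧) * ⟦ lookup A c ⟧)
      ≡⟨ sum-cong-≗ (λ c → *-distribʳ-sum ⟦ lookup A c ⟧ (λ i → ⟦ incident i v ∧ does (colour i ≟ c) ⟧)) ⟩
    ∑[ c < k ] ∑[ i < length E ] (⟦ incident i v ∧ does (colour i ≟ c) ⟧ * ⟦ lookup A c ⟧)
      ≡⟨ ∑-comm (λ c i → ⟦ incident i v ∧ does (colour i ≟ c) ⟧ * ⟦ lookup A c ⟧) ⟩
    ∑[ i < length E ] ∑[ c < k ] (⟦ incident i v ∧ does (colour i ≟ c) ⟧ * ⟦ lookup A c ⟧)
      ≡⟨ sum-cong-≗ (λ i → select (incident i v) (colour i)) ⟩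
    satisfied v A ∎)
    where
    open ≡-Reasoning
    select : ∀ b d → ∑[ c < k ] (⟦ b ∧ does (d ≟ c) ⟧ * ⟦ lookup A c ⟧) ≡ ⟦ b ∧ lookup A d ⟧
    select false d = sum-replicate-zero k
    select true  d = ∑-δ d (λ c → ⟦ lookup A c ⟧)

  satisfied-⁅⁆ : ∀ v x → satisfied v ⁅ x ⁆ ≡ nv E v x
  satisfied-⁅⁆ v x = trans (satisfied≡∑nv v ⁅ x ⁆)
                           (trans (sum-cong-≗ (λ c → cong (λ b → ⟦ b ⟧ * nv E v c) (lookup-⁅⁆ x c))) (∑-δ x (nv E v)))

  misses≤∣e∣ : ∀ μ (e : Edge n k) → misses μ e ≤ ∣ proj₁ e ∣
  misses≤∣e∣ μ (S , c) =
    ≤-trans (∑-mono-≤ (λ v → ⟦∧⟧≤⟦⟧ (lookup S v) _)) (≤-reflexive (sym (∣p∣≡∑ S)))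

  mistake⇒1≤misses : ∀ μ (e : Edge n k) → Mistake μ e → 1 ≤ misses μ e
  mistake⇒1≤misses μ (S , c) (v , v∈S , c∉μv) =
    subst (λ t → t ≤ misses μ (S , c)) (cong₂ (λ a b → ⟦ a ∧ not b ⟧) ([]=⇒lookup v∈S) (∉⇒lookup≡false c∉μv))
          (term≤∑ (λ v → ⟦ lookup S v ∧ not (lookup (μ v) c) ⟧) v)

  ¬mistake⇒misses≡0 : ∀ μ (e : Edge n k) → ¬ Mistake μ e → misses μ e ≡ 0
  ¬mistake⇒misses≡0 μ (S , c) ¬mistake = trans (sum-cong-≗ term≡0) (sum-replicate-zero n)
    where
    term≡0 : ∀ v → ⟦ lookup S v ∧ not (lookup (μ v) c) ⟧ ≡ 0
    term≡0 v with lookup S v in S[v] | lookup (μ v) c in μv[c]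
    ... | false | _     = refl
    ... | true  | true  = refl
    ... | true  | false = contradiction (v , lookup⇒[]= v S S[v] , lookup≡false⇒∉ μv[c]) ¬mistake

  mistakes≤∑misses : ∀ μ → mistakes E μ ≤ totalMisses μ
  mistakes≤∑misses μ = ≤-trans (≤-reflexive (length-filter≡∑ (mistake? μ) E)) (∑-mono-≤ (λ i → bound (edge i)))
    where
    bound : ∀ e → ⟦ does (mistake? μ e) ⟧ ≤ misses μ e
    bound e with mistake? μ e
    ... | yes mistake = mistake⇒1≤misses μ e mistake
    ... | no _        = z≤n

  ∑misses≤rank*mistakes : ∀ μ → totalMisses μ ≤ rank E * mistakes E μ
  ∑misses≤rank*mistakes μ = begin
    totalMisses μ                                  ≤⟨ ∑-mono-≤ bound ⟩
    ∑[ i < length E ] (rank E * mistakeAt i)       ≡⟨ *-distribˡ-sum (rank E) mistakeAt ⟨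
    rank E * ∑[ i < length E ] mistakeAt i         ≡⟨ cong (rank E *_) (length-filter≡∑ (mistake? μ) E) ⟨
    rank E * mistakes E μ                          ∎
    where
    open ≤-Reasoning
    mistakeAt : Fin (length E) → ℕ
    mistakeAt i = ⟦ does (mistake? μ (edge i)) ⟧
    bound : ∀ i → misses μ (edge i) ≤ rank E * mistakeAt i
    bound i with mistake? μ (edge i)
    ... | yes _       = ≤-trans (misses≤∣e∣ μ (edge i))
                                (≤-trans (∣edge∣≤rank E i) (≤-reflexive (sym (*-identityʳ (rank E)))))
    ... | no ¬mistake = ≤-reflexive (trans (¬mistake⇒misses≡0 μ (edge i) ¬mistake) (sym (*-zeroʳ (rank E))))

  -- Every incidence (e , v) is either satisfied at v or one of the misses of e.
  ∑misses+∑satisfied≡∑dv : ∀ μ → totalMisses μ + ∑[ v < n ] satisfied v (μ v)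
                                 ≡ ∑[ v < n ] dv E v
  ∑misses+∑satisfied≡∑dv μ = begin
    totalMisses μ + ∑[ v < n ] satisfied v (μ v)
      ≡⟨ cong (_+ ∑[ v < n ] satisfied v (μ v)) (∑-comm (λ i v → ⟦ incident i v ∧ not (lookup (μ v) (colour i)) ⟧)) ⟩
    ∑[ v < n ] unsatisfied v (μ v) + ∑[ v < n ] satisfied v (μ v)
      ≡⟨ ∑-distrib-+ (λ v → unsatisfied v (μ v)) (λ v → satisfied v (μ v)) ⟨
    ∑[ v < n ] (unsatisfied v (μ v) + satisfied v (μ v))
      ≡⟨ sum-cong-≗ (λ v → dv≡unsatisfied+satisfied v (μ v)) ⟨
    ∑[ v < n ] dv E v ∎
    where open ≡-Reasoning

  mistakes≤rank*mistakes : ∀ γ μ → ∑[ v < n ] satisfied v (μ v) ≤ ∑[ v < n ] satisfied v (γ v) →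
                           mistakes E γ ≤ rank E * mistakes E μ
  mistakes≤rank*mistakes γ μ more-satisfied = begin
    mistakes E γ                                  ≤⟨ mistakes≤∑misses γ ⟩
    totalMisses γ  ≤⟨ fewer-misses ⟩
    totalMisses μ  ≤⟨ ∑misses≤rank*mistakes μ ⟩
    rank E * mistakes E μ                         ∎
    where
    open ≤-Reasoning
    fewer-misses : totalMisses γ ≤ totalMisses μ
    fewer-misses = +-cancelʳ-≤ _ _ _ (begin
      totalMisses γ + ∑[ v < n ] satisfied v (μ v)
        ≤⟨ +-monoʳ-≤ (totalMisses γ) more-satisfied ⟩
      totalMisses γ + ∑[ v < n ] satisfied v (γ v)
        ≡⟨ ∑misses+∑satisfied≡∑dv γ ⟩
      ∑[ v < n ] dv E v
        ≡⟨ ∑misses+∑satisfied≡∑dv μ ⟨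
      totalMisses μ + ∑[ v < n ] satisfied v (μ v) ∎)

module Ranking {n k : ℕ} (E : Hypergraph n k) (π : Ordering n k) where

  open Counting E

  rankedCounts : Fin n → Fin k → ℕ
  rankedCounts v i = nv E v (π v ⟨$⟩ʳ i)

  -- ranked v j is the paper's n_v(π_v(j+1)), and 0 once j ≥ k.
  ranked : Fin n → ℕ → ℕ
  ranked v = extendByZero (rankedCounts v)

  ranked-antitone : Sorted E π → ∀ v → Antitone (ranked v)
  ranked-antitone sorted v = extendByZero-antitone (rankedCounts v) (sorted v)

  satisfied≡∑ranked : ∀ v A → satisfied v A ≡ ∑[ i < k ] (⟦ lookup A (π v ⟨$⟩ʳ i) ⟧ * ranked v (toℕ i))
  satisfied≡∑ranked v A =
    trans (satisfied≡∑nv v A)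
   (trans (sum-permute (λ c → ⟦ lookup A c ⟧ * nv E v c) (π v))
          (sum-cong-≗ (λ i → cong (⟦ lookup A (π v ⟨$⟩ʳ i) ⟧ *_) (sym (extendByZero-toℕ (rankedCounts v) i)))))

  satisfied≤prefix : Sorted E π → ∀ v A → satisfied v A ≤ prefix (ranked v) ∣ A ∣
  satisfied≤prefix sorted v A = begin
    satisfied v A                                  ≡⟨ satisfied≡∑ranked v A ⟩
    ∑[ i < k ] (⟦ A∘π i ⟧ * ranked v (toℕ i))      ≤⟨ ∑-selected≤prefix (ranked v) (ranked-antitone sorted v) A∘π ⟩
    prefix (ranked v) (∑[ i < k ] ⟦ A∘π i ⟧)       ≡⟨ cong (prefix (ranked v)) (∣p∣≡∑-permute (π v) A) ⟨
    prefix (ranked v) ∣ A ∣                        ∎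
    where
    open ≤-Reasoning
    A∘π : Fin k → Bool
    A∘π i = lookup A (π v ⟨$⟩ʳ i)

  satisfied-firstColors : ∀ v m → satisfied v (firstColors (π v) m) ≡ prefix (ranked v) m
  satisfied-firstColors v m =
    trans (satisfied≡∑ranked v (firstColors (π v) m))
   (trans (sum-cong-≗ (λ i → cong (λ b → ⟦ b ⟧ * ranked v (toℕ i)) (lookup-firstColors (π v) m i)))
          (∑-firsts≡prefix (ranked v) (λ j → extendByZero-vanishes (rankedCounts v)) m))

module _ {n k : ℕ} (E : Hypergraph n k) (π : Ordering n k) where

  open Counting E
  open Ranking E π

  localGreedy-feasible : ∀ b → LocalFeasible b (localGreedy π b)
  localGreedy-feasible b v = subst (_≤ b) (sym (∣firstColors∣ (π v) b)) (m⊓n≤m b k)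

  localGreedy-approx : Sorted E π → ∀ b μ → LocalFeasible b μ →
                       mistakes E (localGreedy π b) ≤ rank E * mistakes E μ
  localGreedy-approx sorted b μ feasible = mistakes≤rank*mistakes (localGreedy π b) μ (∑-mono-≤ more-satisfied)
    where
    more-satisfied : ∀ v → satisfied v (μ v) ≤ satisfied v (localGreedy π b v)
    more-satisfied v = begin
      satisfied v (μ v)                   ≤⟨ satisfied≤prefix sorted v (μ v) ⟩
      prefix (ranked v) ∣ μ v ∣           ≤⟨ prefix-monoʳ-≤ (ranked v) (feasible v) ⟩
      prefix (ranked v) b                 ≡⟨ satisfied-firstColors v b ⟨
      satisfied v (localGreedy π b v)     ∎
      where open ≤-Reasoning

  globalRun-bounds : 1 ≤ k → ∀ {t m} → GlobalRun E π t m → ∀ v → 1 ≤ m v × m v ≤ k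
  globalRun-bounds 1≤k start                           v = ≤-refl , 1≤k
  globalRun-bounds 1≤k (step run (add u m<k _)) v with v ≟ u
  ... | yes refl = s≤s z≤n , m<k
  ... | no _     = globalRun-bounds 1≤k run v
  globalRun-bounds 1≤k (step run (full _))              v = globalRun-bounds 1≤k run v

  module GlobalGreedy (sorted : Sorted E π) (1≤k : 1 ≤ k) where

    -- A state m is tracked through extra m = m ∸ 1, the number of colours beyond the first;
    -- giving v its (j+2)-th colour gains marginal v j.
    marginal : Fin n → ℕ → ℕ
    marginal v j = ranked v (suc j)

    open SeparableGreedy marginal (λ v → ranked-antitone sorted v ∘ s≤s)

    extra : (Fin n → ℕ) → Fin n → ℕ
    extra m v = m v ∸ 1

    marginal-extra : ∀ v {j} → 1 ≤ j → marginal v (j ∸ 1) ≡ ranked v j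
    marginal-extra v (s≤s _) = refl

    ∑prefix≡∑head+gain : ∀ m → (∀ v → 1 ≤ m v) →
                          ∑[ v < n ] prefix (ranked v) (m v) ≡ ∑[ v < n ] ranked v 0 + gain (extra m)
    ∑prefix≡∑head+gain m 1≤m =
      trans (sum-cong-≗ (λ v → prefix-split v (1≤m v)))
            (∑-distrib-+ (λ v → ranked v 0) (λ v → prefix (marginal v) (extra m v)))
      where
      prefix-split : ∀ v {j} → 1 ≤ j → prefix (ranked v) j ≡ ranked v 0 + prefix (marginal v) (j ∸ 1)
      prefix-split v (s≤s _) = refl

    globalRun-optimal : ∀ {t m} → GlobalRun E π t m → Optimal t (extra m)
    globalRun-optimal start = optimal-zero
    globalRun-optimal (step {m = m} run (add u m<k maximal)) =
      optimal-resp-≗ extra-bump (optimal-step (globalRun-optimal run) u marginal≤)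
      where
      1≤m : ∀ v → 1 ≤ m v
      1≤m = proj₁ ∘ globalRun-bounds 1≤k run
      extra-bump : updateAt (extra m) u suc ≗ extra (bump m u)
      extra-bump v with v ≟ u
      ... | yes refl = trans (updateAt-updates u (extra m)) (sym (+-∸-assoc 1 (1≤m u)))
      ... | no v≢u   = updateAt-minimal v u (extra m) v≢u
      marginal≤ : ∀ w → marginal w (extra m w) ≤ marginal u (extra m u)
      marginal≤ w = begin
        marginal w (extra m w)       ≡⟨ marginal-extra w (1≤m w) ⟩
        ranked w (m w)               ≤⟨ ranked≤ ⟩
        rankedCounts u (fromℕ< m<k)  ≡⟨ extendByZero-fromℕ< (rankedCounts u) m<k ⟨
        ranked u (m u)               ≡⟨ marginal-extra u (1≤m u) ⟨
        marginal u (extra m u)       ∎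
        where
        open ≤-Reasoning
        ranked≤ : ranked w (m w) ≤ rankedCounts u (fromℕ< m<k)
        ranked≤ with m w <? k
        ... | yes mw<k = ≤-trans (≤-reflexive (extendByZero-fromℕ< (rankedCounts w) mw<k)) (maximal w mw<k)
        ... | no  mw≮k = ≤-trans (≤-reflexive (extendByZero-vanishes (rankedCounts w) (≮⇒≥ mw≮k))) z≤n
    globalRun-optimal (step {m = m} run (full m≥k)) =
      optimal-idle (globalRun-optimal run)
        (λ w → trans (marginal-extra w (proj₁ (globalRun-bounds 1≤k run w))) (extendByZero-vanishes (rankedCounts w) (m≥k w)))

    ∣globalOut∣ : ∀ {t m} → GlobalRun E π t m → ∀ v → ∣ globalOut π m v ∣ ≡ m v
    ∣globalOut∣ run v = trans (∣firstColors∣ (π _) _) (m≤n⇒m⊓n≡m (proj₂ (globalRun-bounds 1≤k run v)))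

    globalGreedy-feasible : ∀ {b m} → GlobalRun E π b m → GlobalFeasible b (globalOut π m)
    globalGreedy-feasible {b} {m} run =
      (λ v → subst (1 ≤_) (sym (∣globalOut∣ run v)) (proj₁ (globalRun-bounds 1≤k run v))) ,
      (begin
        ListAction.sum (map (λ v → ∣ globalOut π m v ∣ ∸ 1) (allFin n))
          ≡⟨ sum-map-allFin (λ v → ∣ globalOut π m v ∣ ∸ 1) ⟩
        ∑[ v < n ] (∣ globalOut π m v ∣ ∸ 1)
          ≡⟨ sum-cong-≗ (λ v → cong (_∸ 1) (∣globalOut∣ run v)) ⟩
        size (extra m)
          ≤⟨ proj₁ (globalRun-optimal run) ⟩
        b ∎)
      where open ≤-Reasoning

    globalGreedy-approx : ∀ {b m} → GlobalRun E π b m → ∀ μ → GlobalFeasible b μ →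
                          mistakes E (globalOut π m) ≤ rank E * mistakes E μ
    globalGreedy-approx {b} {m} run μ (1≤∣μ∣ , budget) = mistakes≤rank*mistakes (globalOut π m) μ (begin
      ∑[ v < n ] satisfied v (μ v)                          ≤⟨ ∑-mono-≤ (λ v → satisfied≤prefix sorted v (μ v)) ⟩
      ∑[ v < n ] prefix (ranked v) ∣ μ v ∣                  ≡⟨ ∑prefix≡∑head+gain (λ v → ∣ μ v ∣) 1≤∣μ∣ ⟩
      ∑[ v < n ] ranked v 0 + gain (extra (λ v → ∣ μ v ∣))  ≤⟨ +-monoʳ-≤ _ (proj₂ (globalRun-optimal run) _ within) ⟩
      ∑[ v < n ] ranked v 0 + gain (extra m)                ≡⟨ ∑prefix≡∑head+gain m (proj₁ ∘ globalRun-bounds 1≤k run) ⟨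
      ∑[ v < n ] prefix (ranked v) (m v)                    ≡⟨ sum-cong-≗ (λ v → satisfied-firstColors v (m v)) ⟨
      ∑[ v < n ] satisfied v (globalOut π m v)              ∎)
      where
      open ≤-Reasoning
      within : size (extra (λ v → ∣ μ v ∣)) ≤ b
      within = ≤-trans (≤-reflexive (sym (sum-map-allFin (λ v → ∣ μ v ∣ ∸ 1)))) budget

module RobustGreedy {n k : ℕ} (E : Hypergraph n (suc k)) (π : Ordering n (suc k)) (sorted : Sorted E π) where

  open Counting E
  open Ranking E π

  -- Deleting v raises the satisfied incidences at v from ranked v 0 to dv E v.
  deletionGain : Fin n → ℕ → ℕ
  deletionGain v zero    = robustScore E π v
  deletionGain v (suc _) = 0

  deletionGain-antitone : ∀ v → Antitone (deletionGain v)
  deletionGain-antitone v {_}     {suc _} _   = z≤n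
  deletionGain-antitone v {zero}  {zero}  _   = ≤-refl

  open SeparableGreedy deletionGain deletionGain-antitone

  deleted : Subset n → Fin n → ℕ
  deleted D v = ⟦ lookup D v ⟧

  dv≡head+deletionGain : ∀ v → dv E v ≡ ranked v 0 + prefix (deletionGain v) 1
  dv≡head+deletionGain v = trans (sym (m+[n∸m]≡n head≤dv)) (cong (ranked v 0 +_) (sym (+-identityʳ _)))
    where
    head≤dv : ranked v 0 ≤ dv E v
    head≤dv = subst (_≤ dv E v) (satisfied-⁅⁆ v (π v ⟨$⟩ʳ fzero)) (satisfied≤dv v ⁅ π v ⟨$⟩ʳ fzero ⁆)

  satisfied-robustOut : ∀ v b → satisfied v (if b then ⊤ else ⁅ π v ⟨$⟩ʳ fzero ⁆)
                                ≡ ranked v 0 + prefix (deletionGain v) ⟦ b ⟧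
  satisfied-robustOut v true  = trans (satisfied-⊤ v) (dv≡head+deletionGain v)
  satisfied-robustOut v false = trans (satisfied-⁅⁆ v (π v ⟨$⟩ʳ fzero)) (sym (+-identityʳ _))

  satisfied≤deletion : ∀ (μ : Coloring n (suc k)) D → (∀ v → v ∉ D → ∣ μ v ∣ ≡ 1) →
                       ∀ v → satisfied v (μ v) ≤ ranked v 0 + prefix (deletionGain v) (deleted D v)
  satisfied≤deletion μ D single v with lookup D v in D[v]
  ... | true  = ≤-trans (satisfied≤dv v (μ v)) (≤-reflexive (dv≡head+deletionGain v))
  ... | false = subst (λ s → satisfied v (μ v) ≤ prefix (ranked v) s) (single v (lookup≡false⇒∉ D[v]))
                      (satisfied≤prefix sorted v (μ v))

  deleted-update : ∀ D u → u ∉ D → updateAt (deleted D) u suc ≗ deleted (D [ u ]≔ inside)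
  deleted-update D u u∉D v with v ≟ u
  ... | yes refl = trans (updateAt-updates u (deleted D))
                   (trans (cong (suc ∘ ⟦_⟧) (∉⇒lookup≡false u∉D)) (sym (cong ⟦_⟧ (lookup∘update u D inside))))
  ... | no v≢u   = trans (updateAt-minimal v u (deleted D) v≢u) (sym (cong ⟦_⟧ (lookup∘update′ v≢u D inside)))

  robustRun-optimal : ∀ {t D} → RobustRun E π t D → Optimal t (deleted D)
  robustRun-optimal start = optimal-resp-≗ (λ v → cong ⟦_⟧ (sym (lookup∘tabulate (λ _ → false) v))) optimal-zero
  robustRun-optimal (step {D = D} run (delete u u∉D maximal)) =
    optimal-resp-≗ (deleted-update D u u∉D) (optimal-step (robustRun-optimal run) u gain≤)
    where
    gain≤ : ∀ w → deletionGain w (deleted D w) ≤ deletionGain u (deleted D u)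
    gain≤ w with lookup D w in D[w] | lookup D u in D[u]
    ... | true  | _     = z≤n
    ... | _     | true  = contradiction (lookup⇒[]= u D D[u]) u∉D
    ... | false | false = maximal w (lookup≡false⇒∉ D[w])
  robustRun-optimal (step {D = D} run (none all-deleted)) =
    optimal-idle (robustRun-optimal run) (λ w → cong (deletionGain w ∘ ⟦_⟧) ([]=⇒lookup (all-deleted w)))

  robustGreedy-feasible : ∀ {b D} → RobustRun E π b D → RobustFeasible b (robustOut π D)
  robustGreedy-feasible {D = D} run =
    D , ≤-trans (≤-reflexive (∣p∣≡∑ D)) (proj₁ (robustRun-optimal run)) ,
    λ v → (λ v∈D → cong (if_then ⊤ else ⁅ π v ⟨$⟩ʳ fzero ⁆) ([]=⇒lookup v∈D)) ,
          (λ v∉D → trans (cong (λ b → ∣ if b then ⊤ else ⁅ π v ⟨$⟩ʳ fzero ⁆ ∣) (∉⇒lookup≡false v∉D))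
                         (∣⁅x⁆∣≡1 (π v ⟨$⟩ʳ fzero)))

  robustGreedy-approx : ∀ {b D} → RobustRun E π b D → ∀ μ → RobustFeasible b μ →
                        mistakes E (robustOut π D) ≤ rank E * mistakes E μ
  robustGreedy-approx {b} {D} run μ (D* , ∣D*∣≤b , spec) = mistakes≤rank*mistakes (robustOut π D) μ (begin
    ∑[ v < n ] satisfied v (μ v)
      ≤⟨ ∑-mono-≤ (satisfied≤deletion μ D* (proj₂ ∘ spec)) ⟩
    ∑[ v < n ] (ranked v 0 + prefix (deletionGain v) (deleted D* v))
      ≡⟨ ∑-distrib-+ (λ v → ranked v 0) (λ v → prefix (deletionGain v) (deleted D* v)) ⟩
    ∑[ v < n ] ranked v 0 + gain (deleted D*)
      ≤⟨ +-monoʳ-≤ _ (proj₂ (robustRun-optimal run) (deleted D*) within) ⟩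
    ∑[ v < n ] ranked v 0 + gain (deleted D)
      ≡⟨ ∑-distrib-+ (λ v → ranked v 0) (λ v → prefix (deletionGain v) (deleted D v)) ⟨
    ∑[ v < n ] (ranked v 0 + prefix (deletionGain v) (deleted D v))
      ≡⟨ sum-cong-≗ (λ v → satisfied-robustOut v (lookup D v)) ⟨
    ∑[ v < n ] satisfied v (robustOut π D v) ∎)
    where
    open ≤-Reasoning
    within : size (deleted D*) ≤ b
    within = ≤-trans (≤-reflexive (sym (∣p∣≡∑ D*))) ∣D*∣≤b

theorem4p1 :
    ∀ (n k : ℕ) .{{_ : NonZero k}} (E : Hypergraph n k) (π : Ordering n k) →
      Sorted E π →
      -- (i) Local Overlapping ECC, budget b ≥ 1
      (∀ (b : ℕ) → 1 ≤ b →
         LocalFeasible b (localGreedy π b) ×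
         (∀ (μ : Coloring n k) → LocalFeasible b μ →
            mistakes E (localGreedy π b) ≤ rank E * mistakes E μ))
      ×
      -- (ii) Global Overlapping ECC, budget b ≥ 0, any run of the greedy
      (∀ (b : ℕ) (m : Fin n → ℕ) → GlobalRun E π b m →
         GlobalFeasible b (globalOut π m) ×
         (∀ (μ : Coloring n k) → GlobalFeasible b μ →
            mistakes E (globalOut π m) ≤ rank E * mistakes E μ))
      ×
      -- (iii) Robust ECC, budget b ≥ 0, any run of the greedy
      (∀ (b : ℕ) (D : Subset n) → RobustRun E π b D →
         RobustFeasible b (robustOut π D) ×
         (∀ (μ : Coloring n k) → RobustFeasible b μ →
            mistakes E (robustOut π D) ≤ rank E * mistakes E μ))
theorem4p1 n (suc k) E π sorted =
  (λ b _ → localGreedy-feasible E π b , localGreedy-approx E π sorted b) ,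
  (λ b m run → globalGreedy-feasible run , globalGreedy-approx run) ,
  (λ b D run → robustGreedy-feasible run , robustGreedy-approx run)
  where
  open GlobalGreedy E π sorted (s≤s z≤n)
  open RobustGreedy E π sorted
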